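{- Let $+,\cdot$ be binary functions and $\overline{sg}, odd$ unary functions satisfying, for all numbers $m,n$: $m+0=m$, $m+S(n)=S(m+n)$; $m\cdot 0=0$, $m\cdot S(n)=m\cdot n+m$; $\overline{sg}(0)=S(0)$, $\overline{sg}(S(n))=0$; $odd(0)=0$, $odd(S(n))=\overline{sg}(odd(n))$. Write $2:=S(S(0))$. Then $PRA_{fcn}$ proves: (i) there exists a unary function $q$ with $q(0)=0$ and $q(S(n))=q(n)+\overline{sg}(odd(S(n)))$ for all $n$; (ii) $odd(S(2\cdot n))=S(0)$ for all $n$; (iii) for any such $q$ as in (i), $q(2\cdot n)=n$ for all $n$.
   Context: The language $L_{fcn}$ is four-sorted: number variables ranging over $\omega$; function variables of arity 1, 2, 3 ranging over unary, binary, ternary functions on $\omega$; a constant $0$ and unary function symbol $S$ (successor). Terms are number variables, $0$, $S(t)$, and $f(t)$, $f(t,q)$, $f(t,q,r)$ for function variables of the corresponding arity; atomic formulas are equations of terms; formulas use connectives and quantifiers over numbers and functions of each arity. Free variables in axioms are read universally. $PRA_{fcn}$ consists of: (1) Successor axioms: $S(n)\neq 0$; $S(n)=S(m)\rightarrow n=m$; $n\neq 0\rightarrow(\exists m)(S(m)=n)$. (2) Initial function axioms: $(\exists f)(\forall m)(f(m)=n)$ ($f$ unary); ternary projections $(\exists f)(\forall m,n,r)(f(m,n,r)=m)$, and likewise with $=n$, $=r$; $(\exists f)(\forall n)(f(n)=S(n))$. (3) Composition axioms: (i) $(\exists f)(\forall m,n,r)(f(m,n,r)=g(m,n))$; (ii)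 $(\exists f)(\forall m,n,r)(f(m,n,r)=g(m))$; (iii) $(\exists f)(\forall m,n)(f(m,n)=g(m,n,r))$; (iv) $(\exists f)(\forall m)(f(m)=g(m,n,r))$; (v) $(\exists f)(\forall m,n,r)(f(m,n,r)=g(h_1(m,n,r),h_2(m,n,r),h_3(m,n,r)))$. (4) $PRA$: for unary $g$ and ternary $h$, $(\exists f)(\forall m)(f(m,0)=g(m)\wedge(\forall n)(f(m,S(n))=h(m,n,f(m,n))))$, $f$ binary. (6) Rudimentary induction: for unary $f,g$: $f(0)=g(0)\wedge(\forall n)(f(n)=g(n)\rightarrow f(S(n))=g(S(n)))\rightarrow f(n)=g(n)$. -}

module Defs where

open import Data.Product using (Σ; _×_; _,_)
open import Relation.Binary.PropositionalEquality using (_≡_)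
open import Relation.Nullary using (¬_)

-- A (Henkin-style, many-sorted) structure for the language L_fcn:
-- a sort of numbers N with 0 and S, and sorts F1, F2, F3 of unary,
-- binary, ternary "functions" with application maps.
record Structure : Set₁ where
  field
    N  : Set
    z  : N
    S  : N → N
    F1 : Set
    F2 : Set
    F3 : Set
    ap1 : F1 → N → N
    ap2 : F2 → N → N → N
    ap3 : F3 → N → N → N → N

record PRAfcnModel : Set₁ where
  field
    structure : Structure
  open Structure structure public
  field
    S≢0     : ∀ n → ¬ (S n ≡ z)
    S-inj   : ∀ n m → S n ≡ S m → n ≡ m
    pred-ex : ∀ n → ¬ (n ≡ z) → Σ N λ m → S m ≡ n
    const   : ∀ n → Σ F1 λ f → ∀ m → ap1 f m ≡ n
    proj₁³  : Σ F3 λ f → ∀ m n r → ap3 f m n r ≡ m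
    proj₂³  : Σ F3 λ f → ∀ m n r → ap3 f m n r ≡ n
    proj₃³  : Σ F3 λ f → ∀ m n r → ap3 f m n r ≡ r
    succ    : Σ F1 λ f → ∀ n → ap1 f n ≡ S n
    comp-i   : ∀ (g : F2) → Σ F3 λ f → ∀ m n r → ap3 f m n r ≡ ap2 g m n
    comp-ii  : ∀ (g : F1) → Σ F3 λ f → ∀ m n r → ap3 f m n r ≡ ap1 g m
    comp-iii : ∀ (g : F3) r → Σ F2 λ f → ∀ m n → ap2 f m n ≡ ap3 g m n r
    comp-iv  : ∀ (g : F3) n r → Σ F1 λ f → ∀ m → ap1 f m ≡ ap3 g m n r
    comp-v   : ∀ (g h₁ h₂ h₃ : F3) → Σ F3 λ f → ∀ m n r →
               ap3 f m n r ≡ ap3 g (ap3 h₁ m n r) (ap3 h₂ m n r) (ap3 h₃ m n r)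
    prim-rec : ∀ (g : F1) (h : F3) → Σ F2 λ f → ∀ m →
               (ap2 f m z ≡ ap1 g m) × (∀ n → ap2 f m (S n) ≡ ap3 h m n (ap2 f m n))
    rud-ind : ∀ (f g : F1) n →
              ap1 f z ≡ ap1 g z →
              (∀ k → ap1 f k ≡ ap1 g k → ap1 f (S k) ≡ ap1 g (S k)) →
              ap1 f n ≡ ap1 g n

-- By the initial-function and composition axioms, every composite of the
-- given functions, such as n ↦ odd(S(2·n)) or n ↦ q(2·n), is computed by a
-- function object, so rudimentary induction proves any equation between two
-- such composites.  By induction odd(S(2·n)) = 1; hence on the way from 2·n
-- to 2·(n+1) the recursion for q adds sḡ(1) = 0 and then sḡ(0) = 1, which
-- gives q(2·n) = n.  The function q comes from primitive recursion with its
-- parameter fixed.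
module Submission where

open import Defs
open import Data.Product using (Σ; _×_; _,_; proj₁; proj₂)
open import Function using (_∘_)
open import Relation.Binary.PropositionalEquality
  using (_≡_; refl; sym; trans; cong; module ≡-Reasoning)

cong₃ : {A B C D : Set} (f : A → B → C → D) {a a′ : A} {b b′ : B} {c c′ : C} →
        a ≡ a′ → b ≡ b′ → c ≡ c′ → f a b c ≡ f a′ b′ c′
cong₃ f refl refl refl = refl

module Definability (M : PRAfcnModel) where
  open PRAfcnModel M
  open ≡-Reasoning

  Definable₁ : (N → N) → Set
  Definable₁ G = Σ F1 λ g → ∀ m → ap1 g m ≡ G m

  Definable₂ : (N → N → N) → Set
  Definable₂ G = Σ F2 λ g → ∀ m n → ap2 g m n ≡ G m n

  Definable₃ : (N → N → N → N) → Set
  Definable₃ G = Σ F3 λ g → ∀ m n r → ap3 g m n r ≡ G m n r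

  ap1-definable : (g : F1) → Definable₁ (ap1 g)
  ap1-definable g = g , λ _ → refl

  ap2-definable : (g : F2) → Definable₂ (ap2 g)
  ap2-definable g = g , λ _ _ → refl

  lift₁ : ∀ {G} → Definable₁ G → Definable₃ (λ m _ _ → G m)
  lift₁ (g , g≗G) = let (f , f≗g) = comp-ii g in
    f , λ m n r → trans (f≗g m n r) (g≗G m)

  lift₂ : ∀ {G} → Definable₂ G → Definable₃ (λ m n _ → G m n)
  lift₂ (g , g≗G) = let (f , f≗g) = comp-i g in
    f , λ m n r → trans (f≗g m n r) (g≗G m n)

  compose₃ : ∀ {G H₁ H₂ H₃} → Definable₃ G →
             Definable₃ H₁ → Definable₃ H₂ → Definable₃ H₃ →
             Definable₃ (λ m n r → G (H₁ m n r) (H₂ m n r) (H₃ m n r))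
  compose₃ (g , g≗G) (h₁ , h₁≗H₁) (h₂ , h₂≗H₂) (h₃ , h₃≗H₃) =
    let (f , f≗gh) = comp-v g h₁ h₂ h₃ in
    f , λ m n r → trans (f≗gh m n r)
          (trans (cong₃ (ap3 g) (h₁≗H₁ m n r) (h₂≗H₂ m n r) (h₃≗H₃ m n r))
                 (g≗G _ _ _))

  fix₃ : ∀ {G} → Definable₃ G → ∀ r → Definable₂ (λ m n → G m n r)
  fix₃ (g , g≗G) r = let (f , f≗g) = comp-iii g r in
    f , λ m n → trans (f≗g m n) (g≗G m n r)

  fix₂₃ : ∀ {G} → Definable₃ G → ∀ n r → Definable₁ (λ m → G m n r)
  fix₂₃ (g , g≗G) n r = let (f , f≗g) = comp-iv g n r in
    f , λ m → trans (f≗g m) (g≗G m n r)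

  id-definable : Definable₁ (λ m → m)
  id-definable = fix₂₃ proj₁³ z z

  ∘-definable : ∀ {G H} → Definable₁ G → Definable₁ H → Definable₁ (G ∘ H)
  ∘-definable g h = fix₂₃ (compose₃ (lift₁ g) (lift₁ h) (lift₁ h) (lift₁ h)) z z

  section-definable : ∀ {G} → Definable₂ G → ∀ c → Definable₁ (G c)
  section-definable g c = fix₂₃ (compose₃ (lift₂ g) (lift₁ (const c)) proj₁³ proj₁³) z z

  definable-induction : ∀ {G H} → Definable₁ G → Definable₁ H →
                        G z ≡ H z → (∀ k → G k ≡ H k → G (S k) ≡ H (S k)) →
                        ∀ n → G n ≡ H n
  definable-induction {G} {H} (g , g≗G) (h , h≗H) base step n =
    from (rud-ind g h n (to z base) λ k gk≡hk → to (S k) (step k (from gk≡hk)))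
    where
    to : ∀ k → G k ≡ H k → ap1 g k ≡ ap1 h k
    to k Gk≡Hk = trans (g≗G k) (trans Gk≡Hk (sym (h≗H k)))

    from : ∀ {k} → ap1 g k ≡ ap1 h k → G k ≡ H k
    from {k} gk≡hk = trans (sym (g≗G k)) (trans gk≡hk (h≗H k))

  primitive-recursion : ∀ {G H} → Definable₁ G → Definable₃ H →
                        Σ F2 λ f → ∀ m → ap2 f m z ≡ G m
                                       × (∀ n → ap2 f m (S n) ≡ H m n (ap2 f m n))
  primitive-recursion (g , g≗G) (h , h≗H) = let (f , f-rec) = prim-rec g h in
    f , λ m → trans (proj₁ (f-rec m)) (g≗G m)
            , λ n → trans (proj₂ (f-rec m) n) (h≗H m n _)

  unary-recursion : ∀ a {H} → Definable₂ H →
                    Σ F1 λ q → ap1 q z ≡ a × (∀ n → ap1 q (S n) ≡ H n (ap1 q n))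
  unary-recursion a {H} h
    with primitive-recursion (const a) (compose₃ (lift₂ h) proj₂³ proj₃³ proj₃³)
  ... | f , f-rec = q , q-zero , q-suc
    where
    q-definable : Definable₁ (ap2 f z)
    q-definable = section-definable (ap2-definable f) z

    q : F1
    q = proj₁ q-definable

    q≗f : ∀ n → ap1 q n ≡ ap2 f z n
    q≗f = proj₂ q-definable

    q-zero : ap1 q z ≡ a
    q-zero = trans (q≗f z) (proj₁ (f-rec z))

    q-suc : ∀ n → ap1 q (S n) ≡ H n (ap1 q n)
    q-suc n = begin
      ap1 q (S n)        ≡⟨ q≗f (S n) ⟩
      ap2 f z (S n)      ≡⟨ proj₂ (f-rec z) n ⟩
      H n (ap2 f z n)    ≡⟨ cong (H n) (sym (q≗f n)) ⟩
      H n (ap1 q n)      ∎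

module Arithmetic (M : PRAfcnModel) where
  open PRAfcnModel M
  open Definability M

  module Halving
    (plus times : F2) (sgbar odd : F1)
    (+-identityʳ : ∀ m → ap2 plus m z ≡ m)
    (+-suc : ∀ m n → ap2 plus m (S n) ≡ S (ap2 plus m n))
    (*-zeroʳ : ∀ m → ap2 times m z ≡ z)
    (*-suc : ∀ m n → ap2 times m (S n) ≡ ap2 plus (ap2 times m n) m)
    (sgbar-zero : ap1 sgbar z ≡ S z)
    (sgbar-suc : ∀ n → ap1 sgbar (S n) ≡ z)
    (odd-zero : ap1 odd z ≡ z)
    (odd-suc : ∀ n → ap1 odd (S n) ≡ ap1 sgbar (ap1 odd n))
    where

    open ≡-Reasoning

    double : N → N
    double = ap2 times (S (S z))

    HalvingRecursion : F1 → Set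
    HalvingRecursion q = ∀ n → ap1 q (S n) ≡ ap2 plus (ap1 q n) (ap1 sgbar (ap1 odd (S n)))

    +-one : ∀ m → ap2 plus m (S z) ≡ S m
    +-one m = trans (+-suc m z) (cong S (+-identityʳ m))

    double-zero : double z ≡ z
    double-zero = *-zeroʳ (S (S z))

    double-suc : ∀ n → double (S n) ≡ S (S (double n))
    double-suc n = begin
      double (S n)                    ≡⟨ *-suc (S (S z)) n ⟩
      ap2 plus (double n) (S (S z))   ≡⟨ +-suc (double n) (S z) ⟩
      S (ap2 plus (double n) (S z))   ≡⟨ cong S (+-one (double n)) ⟩
      S (S (double n))                ∎

    odd-suc-even : ∀ {n} → ap1 odd n ≡ z → ap1 odd (S n) ≡ S z
    odd-suc-even {n} even = trans (odd-suc n) (trans (cong (ap1 sgbar) even) sgbar-zero)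

    odd-suc-odd : ∀ {n} → ap1 odd n ≡ S z → ap1 odd (S n) ≡ z
    odd-suc-odd {n} odd-n = trans (odd-suc n) (trans (cong (ap1 sgbar) odd-n) (sgbar-suc z))

    odd-suc-double : ∀ n → ap1 odd (S (double n)) ≡ S z
    odd-suc-double = definable-induction odd∘S∘double (const (S z)) base step
      where
      odd∘S∘double : Definable₁ (λ n → ap1 odd (S (double n)))
      odd∘S∘double = ∘-definable (ap1-definable odd)
                       (∘-definable succ (section-definable (ap2-definable times) (S (S z))))

      base : ap1 odd (S (double z)) ≡ S z
      base = odd-suc-even (trans (cong (ap1 odd) double-zero) odd-zero)

      step : ∀ k → ap1 odd (S (double k)) ≡ S z → ap1 odd (S (double (S k))) ≡ S z
      step k odd-S-double-k = begin
        ap1 odd (S (double (S k)))        ≡⟨ cong (ap1 odd ∘ S) (double-suc k) ⟩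
        ap1 odd (S (S (S (double k))))   ≡⟨ odd-suc-even (odd-suc-odd odd-S-double-k) ⟩
        S z                              ∎

    halving-exists : Σ F1 λ q → ap1 q z ≡ z × HalvingRecursion q
    halving-exists = unary-recursion z add-increment
      where
      increment : Definable₁ (λ n → ap1 sgbar (ap1 odd (S n)))
      increment = ∘-definable (ap1-definable sgbar) (∘-definable (ap1-definable odd) succ)

      add-increment : Definable₂ (λ n r → ap2 plus r (ap1 sgbar (ap1 odd (S n))))
      add-increment =
        fix₃ (compose₃ (lift₂ (ap2-definable plus)) proj₂³ (lift₁ increment) proj₂³) z

    halving-double : ∀ q → ap1 q z ≡ z → HalvingRecursion q → ∀ n → ap1 q (double n) ≡ n
    halving-double q q-zero q-suc = definable-induction q∘double id-definable base step
      where
      q∘double : Definable₁ (λ n → ap1 q (double n))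
      q∘double = ∘-definable (ap1-definable q) (section-definable (ap2-definable times) (S (S z)))

      base : ap1 q (double z) ≡ z
      base = trans (cong (ap1 q) double-zero) q-zero

      q-suc-via : ∀ {n b} → ap1 odd (S n) ≡ b → ap1 q (S n) ≡ ap2 plus (ap1 q n) (ap1 sgbar b)
      q-suc-via {n} odd-Sn≡b = trans (q-suc n) (cong (ap2 plus (ap1 q n) ∘ ap1 sgbar) odd-Sn≡b)

      q-suc-odd : ∀ {n} → ap1 odd (S n) ≡ S z → ap1 q (S n) ≡ ap1 q n
      q-suc-odd odd-Sn =
        trans (q-suc-via odd-Sn) (trans (cong (ap2 plus _) (sgbar-suc z)) (+-identityʳ _))

      q-suc-even : ∀ {n} → ap1 odd (S n) ≡ z → ap1 q (S n) ≡ S (ap1 q n)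
      q-suc-even even-Sn =
        trans (q-suc-via even-Sn) (trans (cong (ap2 plus _) sgbar-zero) (+-one _))

      step : ∀ k → ap1 q (double k) ≡ k → ap1 q (double (S k)) ≡ S k
      step k q-double-k = begin
        ap1 q (double (S k))       ≡⟨ cong (ap1 q) (double-suc k) ⟩
        ap1 q (S (S (double k)))   ≡⟨ q-suc-even (odd-suc-odd (odd-suc-double k)) ⟩
        S (ap1 q (S (double k)))   ≡⟨ cong S (q-suc-odd (odd-suc-double k)) ⟩
        S (ap1 q (double k))       ≡⟨ cong S q-double-k ⟩
        S k                        ∎

lemma13 : (M : PRAfcnModel) → let open PRAfcnModel M in
    (plus times : F2) (sgbar odd : F1) →
    (∀ m → ap2 plus m z ≡ m) →
    (∀ m n → ap2 plus m (S n) ≡ S (ap2 plus m n)) →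
    (∀ m → ap2 times m z ≡ z) →
    (∀ m n → ap2 times m (S n) ≡ ap2 plus (ap2 times m n) m) →
    (ap1 sgbar z ≡ S z) →
    (∀ n → ap1 sgbar (S n) ≡ z) →
    (ap1 odd z ≡ z) →
    (∀ n → ap1 odd (S n) ≡ ap1 sgbar (ap1 odd n)) →
    (Σ F1 λ q → (ap1 q z ≡ z) ×
       (∀ n → ap1 q (S n) ≡ ap2 plus (ap1 q n) (ap1 sgbar (ap1 odd (S n)))))
    × (∀ n → ap1 odd (S (ap2 times (S (S z)) n)) ≡ S z)
    × (∀ (q : F1) → ap1 q z ≡ z →
         (∀ n → ap1 q (S n) ≡ ap2 plus (ap1 q n) (ap1 sgbar (ap1 odd (S n)))) →
         ∀ n → ap1 q (ap2 times (S (S z)) n) ≡ n)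
lemma13 M plus times sgbar odd +-identityʳ +-suc *-zeroʳ *-suc
        sgbar-zero sgbar-suc odd-zero odd-suc =
  halving-exists , odd-suc-double , halving-double
  where
  open Arithmetic.Halving M plus times sgbar odd +-identityʳ +-suc *-zeroʳ *-suc
         sgbar-zero sgbar-suc odd-zero odd-suc
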